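{- Let $F$ be a partially colored forest and $k\ge 1$. If Alice has a winning strategy in the $k$-Modified Coloring Game ($k$-MCG) played on $\mathcal{R}(F)$, then Alice has a winning strategy in the $k$-coloring game played on $F$.
   Context: The $k$-coloring game on a (possibly partially colored, properly) graph $G$ with a set $C$ of $k$ colors: a color $\alpha\in C$ is legal for a vertex $v$ if no neighbor of $v$ is colored $\alpha$. Alice and Bob alternately color uncolored vertices with legal colors, Alice moving first. If at any point some uncolored vertex has no legal color, Bob wins; Alice wins once every vertex is colored. The $k$-MCG is the same game except that Bob moves first and Bob may choose to pass on any turn. For a partially colored forest $F$, a trunk of $F$ is a maximal connected subgraph $R$ of $F$ such that every colored vertex of $R$ is a leaf of $R$. $\mathcal{R}(F)$ denotes the partially colored forest formed as the disjoint union of all trunks of $F$ (so a colored vertex of degree $d$ in $F$ appears as $d$ separate colored copies, one in each trunk containing it). -}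

module Defs where

open import Data.Nat using (ℕ; suc)
open import Data.Fin using (Fin; zero; suc; inject₁; fromℕ)
open import Data.Maybe using (Maybe; just; nothing)
open import Data.Product using (Σ; Σ-syntax; _×_; _,_)
open import Data.Sum using (_⊎_; inj₁; inj₂)
open import Data.Empty using (⊥)
open import Relation.Nullary using (¬_)
open import Relation.Binary.PropositionalEquality using (_≡_; _≢_)
open import Function.Definitions using (Injective)

record IsSimpleGraph {n : ℕ} (E : Fin n → Fin n → Set) : Set where
  field
    sym   : ∀ u v → E u v → E v u
    irrefl : ∀ v → ¬ E v v

IsForest : {n : ℕ} → (Fin n → Fin n → Set) → Set
IsForest {n} E =
  IsSimpleGraph E ×
  (∀ (j : ℕ) (f : Fin (suc (suc (suc j))) → Fin n) →
     Injective _≡_ _≡_ f →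
     (∀ (i : Fin (suc (suc j))) → E (f (inject₁ i)) (f (suc i))) →
     E (f (fromℕ (suc (suc j)))) (f zero) → ⊥)

-- Partial colorings with colors Fin k  (nothing = uncolored)

IsColored : {V : Set} {k : ℕ} → (V → Maybe (Fin k)) → V → Set
IsColored c v = c v ≢ nothing

ProperPartial : {V : Set} {k : ℕ} → (V → V → Set) → (V → Maybe (Fin k)) → Set
ProperPartial {V} {k} E c = ∀ (u v : V) (α : Fin k) → E u v → c u ≡ just α → c v ≢ just α

Legal : {V : Set} {k : ℕ} → (V → V → Set) → (V → Maybe (Fin k)) → V → Fin k → Set
Legal {V} E c v α = c v ≡ nothing × (∀ (u : V) → E v u → c u ≢ just α)

-- some uncolored vertex has no legal color (Bob has won)
Stuck : {V : Set} {k : ℕ} → (V → V → Set) → (V → Maybe (Fin k)) → Set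
Stuck {V} {k} E c = Σ[ v ∈ V ] (c v ≡ nothing × (∀ (α : Fin k) → ¬ Legal E c v α))

-- every vertex is colored (Alice has won)
Complete : {V : Set} {k : ℕ} → (V → Maybe (Fin k)) → Set
Complete {V} c = ∀ (v : V) → IsColored c v

Step : {V : Set} {k : ℕ} → (V → V → Set) →
       (V → Maybe (Fin k)) → V → Fin k → (V → Maybe (Fin k)) → Set
Step {V} E c v α c' = Legal E c v α × c' v ≡ just α × (∀ (w : V) → w ≢ v → c' w ≡ c w)

-- k-coloring game (Alice first, no passing).
-- CGAlice E k c : Alice to move at position c and she has a winning strategy.
-- CGBob   E k c : Bob   to move at position c and Alice has a winning strategy.

data CGAlice {V : Set} (E : V → V → Set) (k : ℕ) (c : V → Maybe (Fin k)) : Set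
data CGBob   {V : Set} (E : V → V → Set) (k : ℕ) (c : V → Maybe (Fin k)) : Set

data CGAlice {V} E k c where
  done : Complete c → CGAlice E k c
  move : ¬ Stuck E c → (v : V) (α : Fin k) (c' : V → Maybe (Fin k)) →
         Step E c v α c' → CGBob E k c' → CGAlice E k c

data CGBob {V} E k c where
  done : Complete c → CGBob E k c
  reply : ¬ Stuck E c →
          (∀ (v : V) (α : Fin k) (c' : V → Maybe (Fin k)) → Step E c v α c' → CGAlice E k c') →
          CGBob E k c

AliceWinsCG : {V : Set} → (V → V → Set) → (k : ℕ) → (V → Maybe (Fin k)) → Set
AliceWinsCG E k c = CGAlice E k c

-- k-MCG (Bob first, Bob may pass on any turn).

data MCGAlice {V : Set} (E : V → V → Set) (k : ℕ) (c : V → Maybe (Fin k)) : Set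
data MCGBob   {V : Set} (E : V → V → Set) (k : ℕ) (c : V → Maybe (Fin k)) : Set

data MCGAlice {V} E k c where
  done : Complete c → MCGAlice E k c
  move : ¬ Stuck E c → (v : V) (α : Fin k) (c' : V → Maybe (Fin k)) →
         Step E c v α c' → MCGBob E k c' → MCGAlice E k c

data MCGBob {V} E k c where
  done : Complete c → MCGBob E k c
  reply : ¬ Stuck E c →
          (∀ (v : V) (α : Fin k) (c' : V → Maybe (Fin k)) → Step E c v α c' → MCGAlice E k c') →
          MCGAlice E k c →   -- Bob passes
          MCGBob E k c

AliceWinsMCG : {V : Set} → (V → V → Set) → (k : ℕ) → (V → Maybe (Fin k)) → Set
AliceWinsMCG E k c = MCGBob E k c

-- R(F): disjoint union of the trunks of a partially colored forest F.
-- Vertices: each uncolored vertex u of F once (inj₁), and for each colored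
-- vertex v and each neighbour u of v a colored copy (v,u) of v (inj₂),
-- lying in the trunk that contains the edge vu.

RV : {n k : ℕ} → (Fin n → Fin n → Set) → (Fin n → Maybe (Fin k)) → Set
RV {n} E c = (Σ[ u ∈ Fin n ] c u ≡ nothing) ⊎ (Σ[ v ∈ Fin n ] Σ[ u ∈ Fin n ] (IsColored c v × E v u))

RE : {n k : ℕ} → (E : Fin n → Fin n → Set) → (c : Fin n → Maybe (Fin k)) →
     RV E c → RV E c → Set
RE E c (inj₁ (u , _)) (inj₁ (w , _)) = E u w
RE E c (inj₁ (u , _)) (inj₂ (v , w , _)) = w ≡ u
RE E c (inj₂ (v , w , _)) (inj₁ (u , _)) = w ≡ u
-- copies (v,u) and (v',u'): adjacent iff they form a trunk consisting of
-- the single edge vu of F whose ends are both colored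
RE E c (inj₂ (v , u , _)) (inj₂ (v' , u' , _)) = v ≡ u' × u ≡ v'

Rc : {n k : ℕ} → (E : Fin n → Fin n → Set) → (c : Fin n → Maybe (Fin k)) →
     RV E c → Maybe (Fin k)
Rc E c (inj₁ _) = nothing
Rc E c (inj₂ (v , _ , _)) = c v

{-# OPTIONS --safe #-}
-- Alice plays the coloring game on F by shadowing her winning MCG strategy on R(F), treating
-- her opening turn on F as Bob's pass in the MCG.  Every uncolored vertex u of F occurs exactly
-- once in R(F), and the colored copies hanging at u there carry the colors of the colored
-- neighbours of u in F; so u sees the same colors in both graphs, a color is legal for u in F
-- iff it is legal for u in R(F), and each move of either player on F is a move on R(F) and
-- conversely.
module Submission where

open import Defs
open import Data.Nat using (ℕ; _≤_)
open import Data.Fin using (Fin)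
open import Data.Fin.Properties using (_≟_)
open import Data.Maybe using (Maybe; just; nothing)
open import Data.Maybe.Properties using (≡-dec)
open import Data.Vec.Functional using (updateAt)
open import Data.Vec.Functional.Properties using (updateAt-updates; updateAt-minimal)
open import Axiom.UniquenessOfIdentityProofs using (module Decidable⇒UIP)
open import Data.Product using (Σ-syntax; _×_; _,_; proj₁)
open import Data.Sum using (inj₁; inj₂)
open import Data.Sum.Properties using (inj₁-injective)
open import Data.Empty using (⊥-elim)
open import Function using (const; _∘_; _∋_)
open import Relation.Nullary using (yes; no)
open import Relation.Binary.PropositionalEquality

Coloring : Set → ℕ → Set
Coloring V k = V → Maybe (Fin k)

-- forth replays Alice's MCG moves on E′ in the coloring game on E; back replays Bob's moves
-- on E in the MCG on E′.
record Simulation {V W : Set} (E : V → V → Set) (E′ : W → W → Set) (k : ℕ)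
                  (_≼_ : Coloring V k → Coloring W k → Set) : Set where
  field
    complete : ∀ {d r} → d ≼ r → Complete r → Complete d
    stuck    : ∀ {d r} → d ≼ r → Stuck E d → Stuck E′ r
    forth    : ∀ {d r y α r′} → d ≼ r → Step E′ r y α r′ →
               Σ[ x ∈ V ] Σ[ d′ ∈ Coloring V k ] Step E d x α d′ × d′ ≼ r′
    back     : ∀ {d r x α d′} → d ≼ r → Step E d x α d′ →
               Σ[ y ∈ W ] Σ[ r′ ∈ Coloring W k ] Step E′ r y α r′ × d′ ≼ r′

module _ {V W : Set} {E : V → V → Set} {E′ : W → W → Set} {k : ℕ}
         {_≼_ : Coloring V k → Coloring W k → Set} (sim : Simulation E E′ k _≼_) where

  open Simulation sim

  simulateAlice : ∀ {d r} → d ≼ r → MCGAlice E′ k r → CGAlice E k d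
  simulateBob   : ∀ {d r} → d ≼ r → MCGBob E′ k r → CGBob E k d

  simulateAlice d≼r (done r-complete) = done (complete d≼r r-complete)
  simulateAlice d≼r (move r-unstuck _ _ _ step bob) with forth d≼r step
  ... | x , d′ , step′ , d′≼r′ =
    move (r-unstuck ∘ stuck d≼r) x _ d′ step′ (simulateBob d′≼r′ bob)

  simulateBob d≼r (done r-complete) = done (complete d≼r r-complete)
  simulateBob d≼r (reply r-unstuck alice _) = reply (r-unstuck ∘ stuck d≼r) answer
    where
    answer : ∀ x α d′ → Step E _ x α d′ → CGAlice E k d′
    answer x α d′ step with back d≼r step
    ... | y , r′ , step′ , d′≼r′ = simulateAlice d′≼r′ (alice y α r′ step′)

  winsMCG⇒winsCG : ∀ {d r} → d ≼ r → AliceWinsMCG E′ k r → AliceWinsCG E k d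
  winsMCG⇒winsCG d≼r (done r-complete)  = done (complete d≼r r-complete)
  winsMCG⇒winsCG d≼r (reply _ _ pass) = simulateAlice d≼r pass

module Trunks {n k : ℕ} (E : Fin n → Fin n → Set) (E-sym : ∀ u v → E u v → E v u)
              (c : Coloring (Fin n) k) where

  private
    V = Fin n
    W = RV E c
    E′ = RE E c

  lift : Coloring V k → Coloring W k
  lift d (inj₁ (u , _)) = d u
  lift d (inj₂ (v , _)) = c v

  Extends : Coloring V k → Set
  Extends d = ∀ {v a} → c v ≡ just a → d v ≡ just a

  record Tracks (d : Coloring V k) (r : Coloring W k) : Set where
    field
      ≗lift   : r ≗ lift d
      extends : Extends d

  open Tracks

  uncolored-copy-≡ : ∀ {u w} {p : c u ≡ nothing} {q : c w ≡ nothing} →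
                     u ≡ w → (W ∋ inj₁ (u , p)) ≡ inj₁ (w , q)
  uncolored-copy-≡ {p = p} {q} refl =
    cong (inj₁ ∘ (_ ,_)) (Decidable⇒UIP.≡-irrelevant (≡-dec _≟_) p q)

  colored-just : ∀ {v} → IsColored c v → Σ[ a ∈ Fin k ] c v ≡ just a
  colored-just {v} v-colored with c v
  ... | nothing = ⊥-elim (v-colored refl)
  ... | just a  = a , refl

  extends-colored : ∀ {d v} → Extends d → IsColored c v → d v ≡ c v
  extends-colored d-extends v-colored with colored-just v-colored
  ... | a , cv≡a = trans (d-extends cv≡a) (sym cv≡a)

  uncolored-in-c : ∀ {d v} → Extends d → d v ≡ nothing → c v ≡ nothing
  uncolored-in-c {v = v} d-extends dv≡nothing with c v in cv≡
  ... | nothing = refl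
  ... | just a  with () ← trans (sym dv≡nothing) (d-extends cv≡)

  step-extends : ∀ {d u α d′} → Extends d → Step E d u α d′ → Extends d′
  step-extends {u = u} d-extends ((du≡nothing , _) , _ , unchanged) {v} cv≡a =
    trans (unchanged v v≢u) (d-extends cv≡a)
    where
    v≢u : v ≢ u
    v≢u refl with () ← trans (sym (uncolored-in-c d-extends du≡nothing)) cv≡a

  neighbour⇒trunk-neighbour : ∀ {d r u w} {p : c u ≡ nothing} → Tracks d r → E u w →
                              Σ[ y ∈ W ] E′ (inj₁ (u , p)) y × r y ≡ d w
  neighbour⇒trunk-neighbour {u = u} {w} d~r uw with c w in cw≡
  ... | nothing = inj₁ (w , cw≡) , uw , ≗lift d~r _
  ... | just a  = inj₂ (w , u , w-colored , E-sym u w uw) , refl ,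
                  trans (≗lift d~r _) (sym (extends-colored (extends d~r) w-colored))
    where
    w-colored : IsColored c w
    w-colored cw≡nothing with () ← trans (sym cw≡) cw≡nothing

  trunk-neighbour⇒neighbour : ∀ {d r u y} {p : c u ≡ nothing} → Tracks d r →
                              E′ (inj₁ (u , p)) y → Σ[ w ∈ V ] E u w × r y ≡ d w
  trunk-neighbour⇒neighbour {y = inj₁ (w , _)} d~r uw = w , uw , ≗lift d~r _
  trunk-neighbour⇒neighbour {u = u} {y = inj₂ (w , _ , w-colored , wu)} d~r refl =
    w , E-sym w u wu ,
    trans (≗lift d~r _) (sym (extends-colored (extends d~r) w-colored))

  legal-in-trunks⇒legal : ∀ {d r u α} {p : c u ≡ nothing} → Tracks d r →
                          Legal E′ r (inj₁ (u , p)) α → Legal E d u α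
  legal-in-trunks⇒legal d~r (ru≡nothing , free) =
    trans (sym (≗lift d~r _)) ru≡nothing ,
    λ w uw dw≡α → let y , uy , ry≡dw = neighbour⇒trunk-neighbour d~r uw
                  in free y uy (trans ry≡dw dw≡α)

  legal⇒legal-in-trunks : ∀ {d r u α} {p : c u ≡ nothing} → Tracks d r →
                          Legal E d u α → Legal E′ r (inj₁ (u , p)) α
  legal⇒legal-in-trunks d~r (du≡nothing , free) =
    trans (≗lift d~r _) du≡nothing ,
    λ y uy ry≡α → let w , uw , ry≡dw = trunk-neighbour⇒neighbour d~r uy
                  in free w uw (trans (sym ry≡dw) ry≡α)

  tracks-complete : ∀ {d r} → Tracks d r → Complete r → Complete d
  tracks-complete d~r r-complete v dv≡nothing =
    r-complete (inj₁ (v , uncolored-in-c (extends d~r) dv≡nothing))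
               (trans (≗lift d~r _) dv≡nothing)

  tracks-stuck : ∀ {d r} → Tracks d r → Stuck E d → Stuck E′ r
  tracks-stuck d~r (v , dv≡nothing , no-legal) =
    inj₁ (v , uncolored-in-c (extends d~r) dv≡nothing) ,
    trans (≗lift d~r _) dv≡nothing ,
    λ α → no-legal α ∘ legal-in-trunks⇒legal d~r

  lift-step : ∀ {d u α d′} (p : c u ≡ nothing) → Step E d u α d′ →
              ∀ y → y ≢ inj₁ (u , p) → lift d′ y ≡ lift d y
  lift-step _ (_ , _ , unchanged) (inj₁ (w , _)) y≢u = unchanged w (y≢u ∘ uncolored-copy-≡)
  lift-step _ _                   (inj₂ _)       _   = refl

  tracks-forth : ∀ {d r y α r′} → Tracks d r → Step E′ r y α r′ →
          Σ[ x ∈ V ] Σ[ d′ ∈ Coloring V k ] Step E d x α d′ × Tracks d′ r′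
  tracks-forth {y = inj₂ (_ , _ , v-colored , _)} d~r ((ry≡nothing , _) , _) =
    ⊥-elim (v-colored (trans (sym (≗lift d~r _)) ry≡nothing))
  tracks-forth {d} {y = inj₁ (u , p)} {α} {r′} d~r (legal , r′u≡α , unchanged) =
    u , d′ , step , record { ≗lift = r′≗lift ; extends = step-extends (extends d~r) step }
    where
    d′ : Coloring V k
    d′ = updateAt d u (const (just α))

    step : Step E d u α d′
    step = legal-in-trunks⇒legal d~r legal , updateAt-updates u d ,
           λ w w≢u → updateAt-minimal w u d w≢u

    elsewhere : ∀ y → y ≢ inj₁ (u , p) → r′ y ≡ lift d′ y
    elsewhere y y≢u =
      trans (unchanged y y≢u) (trans (≗lift d~r y) (sym (lift-step p step y y≢u)))

    r′≗lift : r′ ≗ lift d′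
    r′≗lift (inj₁ (w , q)) with w ≟ u
    ... | yes refl = trans (cong r′ (uncolored-copy-≡ refl))
                           (trans r′u≡α (sym (updateAt-updates u d)))
    ... | no w≢u   = elsewhere _ (w≢u ∘ cong proj₁ ∘ inj₁-injective)
    r′≗lift (inj₂ y) = elsewhere (inj₂ y) λ ()

  tracks-back : ∀ {d r x α d′} → Tracks d r → Step E d x α d′ →
         Σ[ y ∈ W ] Σ[ r′ ∈ Coloring W k ] Step E′ r y α r′ × Tracks d′ r′
  tracks-back {x = x} {d′ = d′} d~r step@(legal , d′x≡α , _) =
    inj₁ (x , p) , lift d′ ,
    (legal⇒legal-in-trunks d~r legal , d′x≡α ,
     λ y y≢x → trans (lift-step p step y y≢x) (sym (≗lift d~r y))) ,
    record { ≗lift = λ _ → refl ; extends = step-extends (extends d~r) step }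
    where
    p : c x ≡ nothing
    p = uncolored-in-c (extends d~r) (proj₁ legal)

  simulation : Simulation E E′ k Tracks
  simulation = record
    { complete = tracks-complete ; stuck = tracks-stuck ; forth = tracks-forth ; back = tracks-back }

  initially-tracks : Tracks c (Rc E c)
  initially-tracks = record { ≗lift = ≗lift-initial ; extends = λ cv≡a → cv≡a }
    where
    ≗lift-initial : Rc E c ≗ lift c
    ≗lift-initial (inj₁ (_ , cu≡nothing)) = sym cu≡nothing
    ≗lift-initial (inj₂ _)                = refl

lemma2p1 : (n k : ℕ) → 1 ≤ k →
           (E : Fin n → Fin n → Set) → IsForest E →
           (c : Fin n → Maybe (Fin k)) → ProperPartial E c →
           AliceWinsMCG (RE E c) k (Rc E c) →
           AliceWinsCG E k c
lemma2p1 n k _ E (simple , _) c _ = winsMCG⇒winsCG simulation initially-tracks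
  where open Trunks E (IsSimpleGraph.sym simple) c
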